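{- Let $p,q$ be positive integers with $q\ge p-1$, and let $n=p+q$. Let $X\cdot Y=C_{p,q}$ be a Boolean decomposition, where $X$ is an $n\times r$ $0,1$-matrix and $Y$ is an $r\times n$ $0,1$-matrix. Then the total number of entries equal to $1$ in $X$ and $Y$ together is at most $(p+1)n+(r-n)n$.
   Context: For integers $p\ge 1$, $q\ge 0$ and $n=p+q$, $C_{p,q}$ is the $n\times n$ circulant $0,1$-matrix whose entry in row $i$, column $j$ ($1\le i,j\le n$) is $1$ iff $(i-j) \bmod n \in\{0,1,\dots,p-1\}$. A Boolean decomposition $X\cdot Y=C$ means the product is computed with Boolean arithmetic ($1+1=1$, $1+0=0+1=1$, $0+0=0$, ordinary multiplication of $0,1$). -}

module Defs where

open import Data.Bool using (Bool; true; false; _∧_; _∨_)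
open import Data.Nat using (ℕ; zero; suc; _+_; _*_; _<ᵇ_; _∸_; pred)
open import Data.Nat.DivMod using (_%_)
import Data.Fin
open import Data.Fin using (Fin; toℕ)
open import Relation.Binary.PropositionalEquality using (_≡_)

-- 0,1-matrices as Boolean-valued functions on index pairs (true = 1).
Mat : ℕ → ℕ → Set
Mat m k = Fin m → Fin k → Bool

anyFin : (r : ℕ) → (Fin r → Bool) → Bool
anyFin zero    f = false
anyFin (suc r) f = f Data.Fin.zero ∨ anyFin r (λ k → f (Data.Fin.suc k))

_⊙_ : {m r k : ℕ} → Mat m r → Mat r k → Mat m k
_⊙_ {r = r} X Y i j = anyFin r (λ l → X i l ∧ Y l j)

-- The circulant matrix C_{p,q} of size n = p + q (0-based indices; the
-- difference i - j mod n is invariant under the shift to 1-based indices):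
-- entry (i,j) is 1 iff (i - j) mod n ∈ {0,…,p-1}.
C : (p q : ℕ) → Mat (p + q) (p + q)
-- The modulus is written suc (pred n), which equals n whenever n ≥ 1
-- (always the case under the theorem's hypothesis p ≥ 1); this only avoids
-- a NonZero instance argument.
C p q i j = ((toℕ i + (p + q)) ∸ toℕ j) % suc (pred (p + q)) <ᵇ p

bit : Bool → ℕ
bit true  = 1
bit false = 0

sumFin : (r : ℕ) → (Fin r → ℕ) → ℕ
sumFin zero    f = 0
sumFin (suc r) f = f Data.Fin.zero + sumFin r (λ k → f (Data.Fin.suc k))

ones : {m k : ℕ} → Mat m k → ℕ
ones {m} {k} X = sumFin m (λ i → sumFin k (λ j → bit (X i j)))

module Submission where

-- Term k of the decomposition is a rectangle a × b inside the support of C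
-- (a = column k of X, b = row k of Y).  Two facts about a single rectangle:
--   * if a and b are nonempty then |a| + |b| ≤ p + 1 (rectangleBound):
--     rotating the cyclic index set so that a member of b sits at 0 turns
--     the circulant condition into a linear interval condition on [0, n)
--     (IntervalRelated), where a shift-and-gap count applies (IntervalPair);
--   * |a ∩ b| ≤ 1, since for p ≤ q + 1 the support of C meets its transpose
--     only on the diagonal (C-antisymmetric).
-- Hence |a| + |b| + (q - 1)|a ∩ b| ≤ n for every term (termBound).  Every
-- diagonal one of C is covered, so the |a ∩ b| add up to at least n; summing
-- termBound over the r terms gives |X| + |Y| + (q - 1)n ≤ rn
-- (decompositionBound), which is the theorem after rewriting over ℤ.
module CirculantDecomposition where

  open import Defs
  open import Function using (_∘_)
  open import Data.Bool using (Bool; true; false; _∧_; _∨_; T)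
  open import Data.Unit using (tt)
  import Data.Bool.Properties as BoolP
  open BoolP using (¬-not)
  open import Data.Nat
  open import Data.Nat.Properties
  open import Data.Nat.DivMod
  open import Data.Product using (∃; _×_; _,_; proj₁; proj₂)
  open import Data.Sum using (_⊎_; inj₁; inj₂)
  open import Data.Fin as Fin using (Fin; toℕ; fromℕ<)
  import Data.Fin.Properties as FinP
  open FinP using (any?)
  open import Data.Nat.Tactic.RingSolver using (solve-∀)
  open import Algebra.Properties.CommutativeSemigroup +-commutativeSemigroup using (interchange)
  import Data.Integer as ℤ
  open ℤ using (ℤ)
  import Data.Integer.Properties as ℤP
  import Data.Integer.Tactic.RingSolver as ℤSolver
  open import Data.Empty using (⊥; ⊥-elim)
  open import Relation.Nullary using (contradiction; yes; no)
  open import Relation.Binary using (tri<; tri≈; tri>)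
  open import Relation.Binary.PropositionalEquality

  sumTo : ℕ → (ℕ → ℕ) → ℕ
  sumTo zero    f = 0
  sumTo (suc n) f = sumTo n f + f n

  sumTo-cong : ∀ n {f g} → (∀ t → t < n → f t ≡ g t) → sumTo n f ≡ sumTo n g
  sumTo-cong zero    f≡g = refl
  sumTo-cong (suc n) f≡g =
    cong₂ _+_ (sumTo-cong n (λ t t<n → f≡g t (m<n⇒m<1+n t<n))) (f≡g n ≤-refl)

  sumTo-+ : ∀ n f g → sumTo n (λ t → f t + g t) ≡ sumTo n f + sumTo n g
  sumTo-+ zero    f g = refl
  sumTo-+ (suc n) f g = begin
    sumTo n (λ t → f t + g t) + (f n + g n) ≡⟨ cong (_+ (f n + g n)) (sumTo-+ n f g) ⟩
    sumTo n f + sumTo n g + (f n + g n)     ≡⟨ interchange (sumTo n f) (sumTo n g) (f n) (g n) ⟩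
    sumTo n f + f n + (sumTo n g + g n)     ∎
    where open ≡-Reasoning

  sumTo-head : ∀ n f → sumTo (suc n) f ≡ f 0 + sumTo n (λ t → f (suc t))
  sumTo-head zero    f = +-comm 0 (f 0)
  sumTo-head (suc n) f = begin
    sumTo (suc n) f + f (suc n)                  ≡⟨ cong (_+ f (suc n)) (sumTo-head n f) ⟩
    f 0 + sumTo n (λ t → f (suc t)) + f (suc n) ≡⟨ +-assoc (f 0) _ _ ⟩
    f 0 + sumTo (suc n) (λ t → f (suc t))        ∎
    where open ≡-Reasoning

  sumTo-split : ∀ a b f → sumTo (a + b) f ≡ sumTo a f + sumTo b (λ t → f (a + t))
  sumTo-split zero    b f = refl
  sumTo-split (suc a) b f = begin
    sumTo (suc (a + b)) f          ≡⟨ sumTo-head (a + b) f ⟩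
    f 0 + sumTo (a + b) f′         ≡⟨ cong (f 0 +_) (sumTo-split a b f′) ⟩
    f 0 + (sumTo a f′ + rest)      ≡⟨ sym (+-assoc (f 0) _ _) ⟩
    f 0 + sumTo a f′ + rest        ≡⟨ cong (_+ rest) (sym (sumTo-head a f)) ⟩
    sumTo (suc a) f + rest         ∎
    where
    open ≡-Reasoning
    f′ : ℕ → ℕ
    f′ t = f (suc t)
    rest : ℕ
    rest = sumTo b (λ t → f (suc a + t))

  sumTo-rotate : ∀ n f → (∀ t → f (t + n) ≡ f t) → ∀ c → sumTo n (λ t → f (t + c)) ≡ sumTo n f
  sumTo-rotate n f periodic zero    = sumTo-cong n (λ t _ → cong f (+-identityʳ t))
  sumTo-rotate n f periodic (suc c) = begin
    sumTo n (λ t → f (t + suc c))   ≡⟨ sumTo-cong n (λ t _ → cong f (+-suc t c)) ⟩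
    sumTo n (λ t → g (suc t))       ≡⟨ +-cancelˡ-≡ (g 0) _ _ rotateByOne ⟩
    sumTo n g                       ≡⟨ sumTo-rotate n f periodic c ⟩
    sumTo n f                       ∎
    where
    open ≡-Reasoning
    g : ℕ → ℕ
    g t = f (t + c)
    rotateByOne : g 0 + sumTo n (λ t → g (suc t)) ≡ g 0 + sumTo n g
    rotateByOne = begin
      g 0 + sumTo n (λ t → g (suc t)) ≡⟨ sym (sumTo-head n g) ⟩
      sumTo n g + g n                 ≡⟨ cong (sumTo n g +_) (trans (cong f (+-comm n c)) (periodic c)) ⟩
      sumTo n g + g 0                 ≡⟨ +-comm (sumTo n g) (g 0) ⟩
      g 0 + sumTo n g                 ∎

  count : ℕ → (ℕ → Bool) → ℕ
  count n f = sumTo n (λ t → bit (f t))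

  bit≤1 : ∀ b → bit b ≤ 1
  bit≤1 true  = ≤-refl
  bit≤1 false = z≤n

  count≤ : ∀ n f → count n f ≤ n
  count≤ zero    f = z≤n
  count≤ (suc n) f = ≤-trans (+-mono-≤ (count≤ n f) (bit≤1 (f n))) (≤-reflexive (+-comm n 1))

  count-empty : ∀ n f → (∀ t → t < n → f t ≡ false) → count n f ≡ 0
  count-empty zero    f empty = refl
  count-empty (suc n) f empty rewrite empty n ≤-refl =
    trans (+-identityʳ _) (count-empty n f (λ t t<n → empty t (m<n⇒m<1+n t<n)))

  count-witness : ∀ n f → 1 ≤ count n f → ∃ λ t → t < n × f t ≡ true
  count-witness (suc n) f pos with f n in fn
  ... | true  = n , ≤-refl , fn
  ... | false with count-witness n f (≤-trans pos (≤-reflexive (+-identityʳ _)))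
  ...   | t , t<n , ft = t , m<n⇒m<1+n t<n , ft

  count-gap : ∀ n c k f → c + k ≤ n → (∀ t → c ≤ t → t < c + k → f t ≡ false) →
              count n f + k ≤ n
  count-gap n c k f c+k≤n gap with m≤n⇒∃[o]m+o≡n c+k≤n
  ... | e , refl = begin
    count (c + k + e) f + k                             ≡⟨ cong (_+ k) countSplit ⟩
    count c f + count k (λ t → f (c + t)) + rest + k   ≡⟨ cong (λ z → count c f + z + rest + k) gapEmpty ⟩
    count c f + 0 + rest + k                           ≤⟨ +-monoˡ-≤ k (+-mono-≤ (+-monoˡ-≤ 0 (count≤ c f)) (count≤ e _)) ⟩
    c + 0 + e + k                                      ≡⟨ regroup c e k ⟩
    c + k + e                                          ∎
    where
    open ≤-Reasoning
    regroup : ∀ c e k → c + 0 + e + k ≡ c + k + e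
    regroup = solve-∀
    rest : ℕ
    rest = count e (λ t → f (c + k + t))
    countSplit : count (c + k + e) f ≡ count c f + count k (λ t → f (c + t)) + rest
    countSplit = trans (sumTo-split (c + k) e _) (cong (_+ rest) (sumTo-split c k _))
    gapEmpty : count k (λ t → f (c + t)) ≡ 0
    gapEmpty = count-empty k (λ t → f (c + t)) (λ t t<k → gap (c + t) (m≤m+n c t) (+-monoʳ-< c t<k))

  bit-∨ : ∀ x y → (x ≡ true → y ≡ true → ⊥) → bit (x ∨ y) ≡ bit x + bit y
  bit-∨ true  true  both = ⊥-elim (both refl refl)
  bit-∨ true  false _    = refl
  bit-∨ false y     _    = refl

  ∧-split : ∀ {x y} → x ∧ y ≡ true → x ≡ true × y ≡ true
  ∧-split {true} {true} _ = refl , refl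

  count-∨ : ∀ n f g → (∀ t → t < n → f t ≡ true → g t ≡ true → ⊥) →
            count n (λ t → f t ∨ g t) ≡ count n f + count n g
  count-∨ n f g disjoint =
    trans (sumTo-cong n (λ t t<n → bit-∨ (f t) (g t) (disjoint t t<n))) (sumTo-+ n _ _)

  shiftRight : (ℕ → Bool) → ℕ → Bool
  shiftRight f zero    = false
  shiftRight f (suc t) = f t

  count-shiftRight : ∀ n f → f n ≡ false → count (suc n) (shiftRight f) ≡ count (suc n) f
  count-shiftRight n f fn = begin
    count (suc n) (shiftRight f) ≡⟨ sumTo-head n (λ t → bit (shiftRight f t)) ⟩
    count n f                    ≡⟨ sym (+-identityʳ _) ⟩
    count n f + 0                ≡⟨ cong (λ b → count n f + bit b) (sym fn) ⟩
    count (suc n) f              ∎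
    where open ≡-Reasoning

  maximum : ∀ K (f : ℕ → Bool) s → s < K → f s ≡ true →
            ∃ λ M → M < K × f M ≡ true × (∀ t → t < K → f t ≡ true → t ≤ M)
  maximum (suc K) f s s<K fs with f K in fK
  ... | true  = K , ≤-refl , fK , λ t t<1+K _ → s≤s⁻¹ t<1+K
  ... | false with m<1+n⇒m<n∨m≡n s<K
  ...   | inj₂ refl = contradiction (trans (sym fK) fs) λ ()
  ...   | inj₁ s<K′ with maximum K f s s<K′ fs
  ...     | M , M<K , fM , M-max = M , m<n⇒m<1+n M<K , fM , λ t t<1+K ft → M-max t (belowK t t<1+K ft) ft
    where
    belowK : ∀ t → t < suc K → f t ≡ true → t < K
    belowK t t<1+K ft with m<1+n⇒m<n∨m≡n t<1+K
    ... | inj₁ t<K  = t<K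
    ... | inj₂ refl = contradiction (trans (sym fK) ft) λ ()

  -- Two subsets α, β of [0, p + q) are interval-related when every member s
  -- of α and t of β satisfy  t ≤ s < t + p  or  s + q < t.  This is what a
  -- rectangle under the circulant pattern looks like once rotated so that
  -- a member of β sits at 0.
  IntervalRelated : ℕ → ℕ → (ℕ → Bool) → (ℕ → Bool) → Set
  IntervalRelated p q α β = ∀ s t → s < p + q → t < p + q → α s ≡ true → β t ≡ true →
                            (t ≤ s × s < p + t) ⊎ q + s < t

  module IntervalPair (p q′ : ℕ) (α β : ℕ → Bool) (related : IntervalRelated p (suc q′) α β) where

    n : ℕ
    n = p + suc q′

    γ : ℕ → Bool
    γ t = β t ∨ shiftRight α t

    α-below : β 0 ≡ true → ∀ s → s < n → α s ≡ true → s < p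
    α-below β0 s s<n αs with related s 0 s<n (≤-trans (s≤s z≤n) s<n) αs β0
    ... | inj₁ (_ , s<p+0) = subst (s <_) (+-identityʳ p) s<p+0
    ... | inj₂ ()

    -- β never contains t + 1 for a member t of α, since t < t + 1 ≤ t + q.
    β-avoids-shift : ∀ t → t < n → β t ≡ true → shiftRight α t ≡ true → ⊥
    β-avoids-shift (suc t) t+1<n βt+1 αt with related t (suc t) (<-trans (n<1+n t) t+1<n) t+1<n αt βt+1
    ... | inj₁ (t+1≤t , _) = 1+n≰n t+1≤t
    ... | inj₂ q+t<t+1     = 1+n≰n (≤-trans (s≤s (+-monoˡ-≤ t (s≤s z≤n))) q+t<t+1)

    count-γ : α (p + q′) ≡ false → count n γ ≡ count n α + count n β
    count-γ αlast = begin
      count n γ                        ≡⟨ count-∨ n β (shiftRight α) β-avoids-shift ⟩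
      count n β + count n (shiftRight α) ≡⟨ cong (count n β +_) shifted ⟩
      count n β + count n α            ≡⟨ +-comm (count n β) _ ⟩
      count n α + count n β            ∎
      where
      open ≡-Reasoning
      shifted : count n (shiftRight α) ≡ count n α
      shifted = subst (λ m → count m (shiftRight α) ≡ count m α) (sym (+-suc p q′))
                      (count-shiftRight (p + q′) α αlast)

    gap-inside : ∀ M → M < p → 2 + M + q′ ≤ n
    gap-inside M M<p = ≤-trans (≤-reflexive (sym (+-suc (suc M) q′))) (+-monoˡ-≤ (suc q′) M<p)

    -- If M < p is the largest member of α, then γ misses the q′ points
    -- M + 2, …, M + q′ + 1: β has no points in (M, M + q], and α + 1 none above M + 1.
    γ-gap : ∀ M → M < p → α M ≡ true → (∀ s → s < n → α s ≡ true → s ≤ M) →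
            ∀ t → 2 + M ≤ t → t < 2 + M + q′ → γ t ≡ false
    γ-gap M M<p αM M-max (suc t) (s≤s M+1≤t) t+1<M+2+q′ = cong₂ _∨_ βfalse αfalse
      where
      t+1<n : suc t < n
      t+1<n = <-≤-trans t+1<M+2+q′ (gap-inside M M<p)
      t≤M+q′ : t ≤ M + q′
      t≤M+q′ = s≤s⁻¹ (s≤s⁻¹ t+1<M+2+q′)
      βfalse : β (suc t) ≡ false
      βfalse with β (suc t) in βt+1
      ... | false = refl
      ... | true with related M (suc t) (<-≤-trans M<p (m≤m+n p _)) t+1<n αM βt+1
      ...   | inj₁ (t+1≤M , _) = contradiction (≤-trans M+1≤t (≤-trans (n≤1+n t) t+1≤M)) 1+n≰n
      ...   | inj₂ q+M<t+1     = contradiction (≤-trans (s≤s⁻¹ q+M<t+1) (≤-trans t≤M+q′ (≤-reflexive (+-comm M q′)))) 1+n≰n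
      αfalse : α t ≡ false
      αfalse with α t in αt
      ... | false = refl
      ... | true  = contradiction (≤-trans M+1≤t (M-max t (<-trans (n<1+n t) t+1<n) αt)) 1+n≰n

    -- If 0 ∈ β and α ≠ ∅, then |α| + |β| ≤ p + 1: with M = max α < p, the
    -- set γ has |α| + |β| members and a gap of q′ points, so at most
    -- n - q′ = p + 1 members.
    intervalBound : β 0 ≡ true → ∀ s₀ → s₀ < n → α s₀ ≡ true → count n α + count n β ≤ suc p
    intervalBound β0 s₀ s₀<n αs₀ with maximum p α s₀ (α-below β0 s₀ s₀<n αs₀) αs₀
    ... | M , M<p , αM , M-max = +-cancelʳ-≤ q′ _ _ (begin
      count n α + count n β + q′ ≡⟨ cong (_+ q′) (sym (count-γ αlast)) ⟩
      count n γ + q′             ≤⟨ count-gap n (2 + M) q′ γ (gap-inside M M<p) (γ-gap M M<p αM M-max′) ⟩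
      n                          ≡⟨ +-suc p q′ ⟩
      suc p + q′                 ∎)
      where
      open ≤-Reasoning
      αlast : α (p + q′) ≡ false
      αlast with α (p + q′) in αl
      ... | false = refl
      ... | true  = contradiction (≤-trans (α-below β0 _ (≤-reflexive (sym (+-suc p q′))) αl) (m≤m+n p q′)) 1+n≰n
      M-max′ : ∀ s → s < n → α s ≡ true → s ≤ M
      M-max′ s s<n αs = M-max s (α-below β0 s s<n αs) αs

  sumFin≡sumTo : ∀ n (g : Fin n → ℕ) (h : ℕ → ℕ) → (∀ i → g i ≡ h (toℕ i)) → sumFin n g ≡ sumTo n h
  sumFin≡sumTo zero    g h g≡h = refl
  sumFin≡sumTo (suc n) g h g≡h = begin
    g Fin.zero + sumFin n (λ i → g (Fin.suc i)) ≡⟨ cong₂ _+_ (g≡h Fin.zero) (sumFin≡sumTo n _ _ (λ i → g≡h (Fin.suc i))) ⟩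
    h 0 + sumTo n (λ t → h (suc t))             ≡⟨ sym (sumTo-head n h) ⟩
    sumTo (suc n) h                             ∎
    where open ≡-Reasoning

  sumFin-mono : ∀ n (f g : Fin n → ℕ) → (∀ i → f i ≤ g i) → sumFin n f ≤ sumFin n g
  sumFin-mono zero    f g f≤g = z≤n
  sumFin-mono (suc n) f g f≤g = +-mono-≤ (f≤g Fin.zero) (sumFin-mono n _ _ (λ i → f≤g (Fin.suc i)))

  sumFin-+ : ∀ n (f g : Fin n → ℕ) → sumFin n (λ i → f i + g i) ≡ sumFin n f + sumFin n g
  sumFin-+ zero    f g = refl
  sumFin-+ (suc n) f g = trans (cong (f Fin.zero + g Fin.zero +_) (sumFin-+ n _ _))
                               (interchange (f Fin.zero) (g Fin.zero) _ _)

  sumFin-*ˡ : ∀ n c (f : Fin n → ℕ) → sumFin n (λ i → c * f i) ≡ c * sumFin n f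
  sumFin-*ˡ zero    c f = sym (*-zeroʳ c)
  sumFin-*ˡ (suc n) c f = trans (cong (c * f Fin.zero +_) (sumFin-*ˡ n c _)) (sym (*-distribˡ-+ c (f Fin.zero) _))

  sumFin-const : ∀ n c → sumFin n (λ _ → c) ≡ n * c
  sumFin-const zero    c = refl
  sumFin-const (suc n) c = cong (c +_) (sumFin-const n c)

  sumFin-swap : ∀ m k (f : Fin m → Fin k → ℕ) →
                sumFin m (λ i → sumFin k (f i)) ≡ sumFin k (λ j → sumFin m (λ i → f i j))
  sumFin-swap zero    k f = sym (trans (sumFin-const k 0) (*-zeroʳ k))
  sumFin-swap (suc m) k f = trans (cong (sumFin k (f Fin.zero) +_) (sumFin-swap m k (λ i → f (Fin.suc i))))
                                  (sym (sumFin-+ k (f Fin.zero) _))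

  card : ∀ n → (Fin n → Bool) → ℕ
  card n a = sumFin n (λ i → bit (a i))

  card-empty : ∀ n a → (∀ i → a i ≡ false) → card n a ≡ 0
  card-empty zero    a empty = refl
  card-empty (suc n) a empty rewrite empty Fin.zero = card-empty n (λ i → a (Fin.suc i)) (λ i → empty (Fin.suc i))

  card-member : ∀ n a i → a i ≡ true → 1 ≤ card n a
  card-member (suc n) a Fin.zero    ai rewrite ai = s≤s z≤n
  card-member (suc n) a (Fin.suc i) ai = ≤-trans (card-member n (λ j → a (Fin.suc j)) i ai) (m≤n+m _ (bit (a Fin.zero)))

  card-disjoint : ∀ n a b → (∀ i → a i ≡ true → b i ≡ true → ⊥) → card n a + card n b ≤ n
  card-disjoint zero    a b disjoint = z≤n
  card-disjoint (suc n) a b disjoint = begin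
    bit (a Fin.zero) + A + (bit (b Fin.zero) + B)     ≡⟨ interchange (bit (a Fin.zero)) A (bit (b Fin.zero)) B ⟩
    bit (a Fin.zero) + bit (b Fin.zero) + (A + B)     ≡⟨ cong (_+ (A + B)) (sym (bit-∨ _ _ (disjoint Fin.zero))) ⟩
    bit (a Fin.zero ∨ b Fin.zero) + (A + B)           ≤⟨ +-mono-≤ (bit≤1 (a Fin.zero ∨ b Fin.zero))
                                                                  (card-disjoint n _ _ (λ i → disjoint (Fin.suc i))) ⟩
    suc n                                             ∎
    where
    open ≤-Reasoning
    A = card n (λ i → a (Fin.suc i))
    B = card n (λ i → b (Fin.suc i))

  card-atMostOne : ∀ n a → (∀ i j → a i ≡ true → a j ≡ true → i ≡ j) → card n a ≤ 1
  card-atMostOne zero    a unique = z≤n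
  card-atMostOne (suc n) a unique with a Fin.zero in a0
  ... | true  = ≤-reflexive (cong suc (card-empty n _ onlyZero))
    where
    onlyZero : ∀ i → a (Fin.suc i) ≡ false
    onlyZero i with a (Fin.suc i) in ai
    ... | false = refl
    ... | true  = contradiction (unique Fin.zero (Fin.suc i) a0 ai) λ ()
  ... | false = card-atMostOne n _ (λ i j ai aj → FinP.suc-injective (unique (Fin.suc i) (Fin.suc j) ai aj))

  anyFin-intro : ∀ r (f : Fin r → Bool) k → f k ≡ true → anyFin r f ≡ true
  anyFin-intro (suc r) f Fin.zero    fk rewrite fk = refl
  anyFin-intro (suc r) f (Fin.suc k) fk with f Fin.zero
  ... | true  = refl
  ... | false = anyFin-intro r (λ k → f (Fin.suc k)) k fk

  anyFin⇒card : ∀ r (f : Fin r → Bool) → anyFin r f ≡ true → 1 ≤ card r f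
  anyFin⇒card (suc r) f any with f Fin.zero
  ... | true  = s≤s z≤n
  ... | false = anyFin⇒card r (λ k → f (Fin.suc k)) any

  -- Residues modulo N = m + 1.  cyclicDiff x y is the residue of x - y,
  -- computed exactly as in the definition of C.
  module Cyclic (m : ℕ) where

    N : ℕ
    N = suc m

    cyclicDiff : ℕ → ℕ → ℕ
    cyclicDiff x y = ((x + N) ∸ y) % N

    cyclicDiff-self : ∀ x → cyclicDiff x x ≡ 0
    cyclicDiff-self x = trans (cong (_% N) (m+n∸m≡n x N)) (n%n≡0 N)

    cyclicDiff-≥ : ∀ {x y} → y ≤ x → x < N → cyclicDiff x y ≡ x ∸ y
    cyclicDiff-≥ {x} {y} y≤x x<N = begin
      ((x + N) ∸ y) % N ≡⟨ cong (_% N) (+-∸-comm N y≤x) ⟩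
      ((x ∸ y) + N) % N ≡⟨ [m+n]%n≡m%n (x ∸ y) N ⟩
      (x ∸ y) % N       ≡⟨ m<n⇒m%n≡m (≤-<-trans (m∸n≤m x y) x<N) ⟩
      x ∸ y             ∎
      where open ≡-Reasoning

    cyclicDiff-< : ∀ {x y} → x < y → y < N → cyclicDiff x y ≡ (x + N) ∸ y
    cyclicDiff-< {x} {y} x<y y<N = m<n⇒m%n≡m (subst ((x + N) ∸ y <_) (m+n∸m≡n y N)
      (∸-monoˡ-< (+-monoˡ-< N x<y) (≤-trans (<⇒≤ y<N) (m≤n+m N x))))

    cyclicDiff-antisym : ∀ {x y} → y < x → x < N → cyclicDiff x y + cyclicDiff y x ≡ N
    cyclicDiff-antisym {x} {y} y<x x<N with m≤n⇒∃[o]m+o≡n (<⇒≤ y<x)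
    ... | d , refl = begin
      cyclicDiff (y + d) y + cyclicDiff y (y + d) ≡⟨ cong₂ _+_ (cyclicDiff-≥ (m≤m+n y d) x<N) (cyclicDiff-< y<x x<N) ⟩
      (y + d) ∸ y + ((y + N) ∸ (y + d))         ≡⟨ cong₂ _+_ (m+n∸m≡n y d) ([m+n]∸[m+o]≡n∸o y N d) ⟩
      d + (N ∸ d)                               ≡⟨ m+[n∸m]≡n (≤-trans (m≤n+m d y) (<⇒≤ x<N)) ⟩
      N                                         ∎
      where open ≡-Reasoning

    -- Subtracting y is adding m * y, since -1 ≡ m (mod N).
    cyclicDiff-negate : ∀ x y → y ≤ N → cyclicDiff x y ≡ (x + m * y) % N
    cyclicDiff-negate x y y≤N = begin
      z % N               ≡⟨ sym ([m+kn]%n≡m%n z y N) ⟩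
      (z + y * N) % N     ≡⟨ cong (_% N) unfold ⟩
      (x + m * y + N) % N ≡⟨ [m+n]%n≡m%n (x + m * y) N ⟩
      (x + m * y) % N     ∎
      where
      open ≡-Reasoning
      z = (x + N) ∸ y
      unfold : z + y * N ≡ x + m * y + N
      unfold = begin
        z + y * N     ≡⟨ split z y m ⟩
        z + y + m * y ≡⟨ cong (_+ m * y) (m∸n+n≡m (≤-trans y≤N (m≤n+m N x))) ⟩
        x + N + m * y ≡⟨ reorder x m y ⟩
        x + m * y + N ∎
        where
        split : ∀ z y m → z + y * suc m ≡ z + y + m * y
        split = solve-∀
        reorder : ∀ x m y → x + suc m + m * y ≡ x + m * y + suc m
        reorder = solve-∀

    residue-linear : ∀ a k b → (a % N + k * (b % N)) % N ≡ (a + k * b) % N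
    residue-linear a k b = begin
      (a % N + k * (b % N)) % N               ≡⟨ %-distribˡ-+ (a % N) _ N ⟩
      (a % N % N + (k * (b % N)) % N) % N     ≡⟨ cong₂ (λ u v → (u + v) % N) (m%n%n≡m%n a N) scaled ⟩
      (a % N + (k * b) % N) % N               ≡⟨ sym (%-distribˡ-+ a (k * b) N) ⟩
      (a + k * b) % N                         ∎
      where
      open ≡-Reasoning
      scaled : (k * (b % N)) % N ≡ (k * b) % N
      scaled = begin
        (k * (b % N)) % N           ≡⟨ %-distribˡ-* k (b % N) N ⟩
        (k % N * (b % N % N)) % N   ≡⟨ cong (λ u → (k % N * u) % N) (m%n%n≡m%n b N) ⟩
        (k % N * (b % N)) % N       ≡⟨ sym (%-distribˡ-* k b N) ⟩
        (k * b) % N                 ∎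

    cyclicDiff-rotate : ∀ s t c → t < N → cyclicDiff ((s + c) % N) ((t + c) % N) ≡ cyclicDiff s t
    cyclicDiff-rotate s t c t<N = begin
      cyclicDiff ((s + c) % N) ((t + c) % N)   ≡⟨ cyclicDiff-negate _ _ (<⇒≤ (m%n<n (t + c) N)) ⟩
      ((s + c) % N + m * ((t + c) % N)) % N    ≡⟨ residue-linear (s + c) m (t + c) ⟩
      (s + c + m * (t + c)) % N                ≡⟨ cong (_% N) (collect s c m t) ⟩
      (s + m * t + c * N) % N                  ≡⟨ [m+kn]%n≡m%n (s + m * t) c N ⟩
      (s + m * t) % N                          ≡⟨ sym (cyclicDiff-negate s t (<⇒≤ t<N)) ⟩
      cyclicDiff s t                           ∎
      where
      open ≡-Reasoning
      collect : ∀ s c m t → s + c + m * (t + c) ≡ s + m * t + c * suc m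
      collect = solve-∀

  module Circulant (p′ q′ : ℕ) where

    p q : ℕ
    p = suc p′
    q = suc q′

    open Cyclic (p′ + q) public

    C-cyclicDiff : ∀ i j → C p q i j ≡ true → cyclicDiff (toℕ i) (toℕ j) < p
    C-cyclicDiff i j Cij = <ᵇ⇒< _ p (subst T (sym Cij) tt)

    C-diagonal : ∀ i → C p q i i ≡ true
    C-diagonal i = cong (_<ᵇ p) (cyclicDiff-self (toℕ i))

    cyclicDiff-interval : ∀ s t → s < N → t < N → cyclicDiff s t < p → (t ≤ s × s < p + t) ⊎ q + s < t
    cyclicDiff-interval s t s<N t<N d<p with t ≤? s
    ... | yes t≤s = inj₁ (t≤s , subst (_< p + t) (m∸n+n≡m t≤s) (+-monoˡ-< t s∸t<p))
      where
      s∸t<p : s ∸ t < p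
      s∸t<p = subst (_< p) (cyclicDiff-≥ t≤s s<N) d<p
    ... | no  t≰s = inj₂ (+-cancelˡ-< p (q + s) t (subst (_< p + t) total (+-monoˡ-< t d<p′)))
      where
      s<t = ≰⇒> t≰s
      d<p′ : (s + N) ∸ t < p
      d<p′ = subst (_< p) (cyclicDiff-< s<t t<N) d<p
      total : (s + N) ∸ t + t ≡ p + (q + s)
      total = trans (m∸n+n≡m (≤-trans (<⇒≤ t<N) (m≤n+m N s))) (rearrange s p′ q′)
        where
        rearrange : ∀ s p′ q′ → s + suc (p′ + suc q′) ≡ suc p′ + (suc q′ + s)
        rearrange = solve-∀

    belowP-sum≢N : p ≤ q + 1 → ∀ {u v} → u < p → v < p → u + v ≢ N
    belowP-sum≢N p≤q+1 {u} {v} u<p v<p u+v≡N = 1+n≰n (begin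
      suc (suc N)       ≡⟨ cong (suc ∘ suc) (sym u+v≡N) ⟩
      suc (suc (u + v)) ≡⟨ sym (+-suc (suc u) v) ⟩
      suc u + suc v     ≤⟨ +-mono-≤ u<p v<p ⟩
      p + p             ≤⟨ +-monoʳ-≤ p p≤q+1 ⟩
      p + (q + 1)       ≡⟨ reorder p′ q′ ⟩
      suc N             ∎)
      where
      open ≤-Reasoning
      reorder : ∀ p′ q′ → suc p′ + (suc q′ + 1) ≡ suc (suc (p′ + suc q′))
      reorder = solve-∀

    -- Hence the support of C meets its transpose only on the diagonal:
    -- otherwise x - y and y - x, adding up to N, would both be below p.
    C-antisymmetric : p ≤ q + 1 → ∀ i j → C p q i j ≡ true → C p q j i ≡ true → i ≡ j
    C-antisymmetric p≤q+1 i j Cij Cji with <-cmp (toℕ i) (toℕ j)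
    ... | tri≈ _ i≡j _ = FinP.toℕ-injective i≡j
    ... | tri< i<j _ _ = contradiction (cyclicDiff-antisym i<j (FinP.toℕ<n j))
                                       (belowP-sum≢N p≤q+1 (C-cyclicDiff j i Cji) (C-cyclicDiff i j Cij))
    ... | tri> _ _ j<i = contradiction (cyclicDiff-antisym j<i (FinP.toℕ<n i))
                                       (belowP-sum≢N p≤q+1 (C-cyclicDiff i j Cij) (C-cyclicDiff j i Cji))

    extend : (Fin N → Bool) → ℕ → Bool
    extend a x = a (fromℕ< (m%n<n x N))

    extend-toℕ : ∀ a i → extend a (toℕ i) ≡ a i
    extend-toℕ a i = cong a (trans (FinP.fromℕ<-cong _ _ (m<n⇒m%n≡m (FinP.toℕ<n i)) _ (FinP.toℕ<n i))
                                   (FinP.fromℕ<-toℕ i _))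

    extend-periodic : ∀ a t → extend a (t + N) ≡ extend a t
    extend-periodic a t = cong a (FinP.fromℕ<-cong _ _ ([m+n]%n≡m%n t N) _ _)

    card-rotate : ∀ a c → card N a ≡ count N (λ t → extend a (t + c))
    card-rotate a c = trans (sumFin≡sumTo N _ (λ t → bit (extend a t)) (λ i → cong bit (sym (extend-toℕ a i))))
                            (sym (sumTo-rotate N (λ t → bit (extend a t)) (λ t → cong bit (extend-periodic a t)) c))

    Rectangle : (Fin N → Bool) → (Fin N → Bool) → Set
    Rectangle a b = ∀ i j → a i ≡ true → b j ≡ true → C p q i j ≡ true

    rectangle-interval : ∀ a b → Rectangle a b → ∀ c →
                         IntervalRelated p q (λ s → extend a (s + c)) (λ t → extend b (t + c))
    rectangle-interval a b rect c s t s<N t<N as bt = cyclicDiff-interval s t s<N t<N (begin-strict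
      cyclicDiff s t                                ≡⟨ sym (cyclicDiff-rotate s t c t<N) ⟩
      cyclicDiff ((s + c) % N) ((t + c) % N)        ≡⟨ sym (cong₂ cyclicDiff (FinP.toℕ-fromℕ< (m%n<n (s + c) N))
                                                                              (FinP.toℕ-fromℕ< (m%n<n (t + c) N))) ⟩
      cyclicDiff (toℕ i) (toℕ j)                    <⟨ C-cyclicDiff i j (rect i j as bt) ⟩
      p                                             ∎)
      where
      open ≤-Reasoning
      i j : Fin N
      i = fromℕ< (m%n<n (s + c) N)
      j = fromℕ< (m%n<n (t + c) N)

    -- Key lemma: a nonempty rectangle a × b in the support of C has
    -- |a| + |b| ≤ p + 1.  Rotate so that a member of b sits at 0.
    rectangleBound : ∀ a b → Rectangle a b → ∀ i₀ j₀ → a i₀ ≡ true → b j₀ ≡ true →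
                     card N a + card N b ≤ suc p
    rectangleBound a b rect i₀ j₀ ai₀ bj₀ =
      subst₂ (λ x y → x + y ≤ suc p) (sym (card-rotate a c)) (sym (card-rotate b c))
        (IntervalPair.intervalBound p q′ α β (rectangle-interval a b rect c) β0 s₀ s₀<N αs₀)
      where
      c = toℕ j₀
      α β : ℕ → Bool
      α s = extend a (s + c)
      β t = extend b (t + c)
      β0 : β 0 ≡ true
      β0 = trans (extend-toℕ b j₀) bj₀
      αNonempty = count-witness N α (subst (1 ≤_) (card-rotate a c) (card-member N a i₀ ai₀))
      s₀ = proj₁ αNonempty
      s₀<N = proj₁ (proj₂ αNonempty)
      αs₀ = proj₂ (proj₂ αNonempty)

    -- If a and b meet,
    -- the rectangle bound gives |a| + |b| ≤ p + 1 and antisymmetry gives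
    -- |a ∩ b| ≤ 1; otherwise a and b are disjoint and a ∩ b is empty.
    termBound : p ≤ q + 1 → ∀ a b → Rectangle a b →
                card N a + card N b + q′ * card N (λ i → a i ∧ b i) ≤ N
    termBound p≤q+1 a b rect with any? (λ i → a i ∧ b i BoolP.≟ true)
    ... | yes (i , abi) = begin
      card N a + card N b + q′ * card N (λ i → a i ∧ b i) ≤⟨ +-mono-≤ (rectangleBound a b rect i i ai bi)
                                                                      (*-monoʳ-≤ q′ meetAtMostOnce) ⟩
      suc p + q′ * 1                                      ≡⟨ cong (suc p +_) (*-identityʳ q′) ⟩
      suc p + q′                                          ≡⟨ sym (+-suc p q′) ⟩
      N                                                   ∎
      where
      open ≤-Reasoning
      ai = proj₁ (∧-split abi)
      bi = proj₂ (∧-split abi)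
      meetAtMostOnce : card N (λ i → a i ∧ b i) ≤ 1
      meetAtMostOnce = card-atMostOne N _ λ i j abi abj →
        C-antisymmetric p≤q+1 i j (rect i j (proj₁ (∧-split abi)) (proj₂ (∧-split abj)))
                                  (rect j i (proj₁ (∧-split abj)) (proj₂ (∧-split abi)))
    ... | no noMeet = begin
      card N a + card N b + q′ * card N (λ i → a i ∧ b i) ≡⟨ cong (λ k → card N a + card N b + q′ * k) meetEmpty ⟩
      card N a + card N b + q′ * 0                        ≡⟨ cong (card N a + card N b +_) (*-zeroʳ q′) ⟩
      card N a + card N b + 0                             ≡⟨ +-identityʳ _ ⟩
      card N a + card N b                                 ≤⟨ card-disjoint N a b (λ i ai bi → noMeet (i , cong₂ _∧_ ai bi)) ⟩
      N                                                   ∎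
      where
      open ≤-Reasoning
      meetEmpty : card N (λ i → a i ∧ b i) ≡ 0
      meetEmpty = card-empty N _ (λ i → ¬-not (λ abi → noMeet (i , abi)))

    IsDecomposition : ∀ {r} → Mat N r → Mat r N → Set
    IsDecomposition X Y = ∀ i j → (X ⊙ Y) i j ≡ C p q i j

    term-rectangle : ∀ {r} (X : Mat N r) Y → IsDecomposition X Y → ∀ k →
                     Rectangle (λ i → X i k) (λ j → Y k j)
    term-rectangle {r} X Y decomp k i j Xik Ykj =
      trans (sym (decomp i j)) (anyFin-intro r (λ l → X i l ∧ Y l j) k (cong₂ _∧_ Xik Ykj))

    -- The N diagonal ones of C are covered, so the terms meet the diagonal
    -- at least N times in total.
    diagonalCover : ∀ {r} (X : Mat N r) Y → IsDecomposition X Y →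
                    N ≤ sumFin r (λ k → card N (λ i → X i k ∧ Y k i))
    diagonalCover {r} X Y decomp = begin
      N                                                  ≡⟨ sym (trans (sumFin-const N 1) (*-identityʳ N)) ⟩
      sumFin N (λ _ → 1)                                 ≤⟨ sumFin-mono N _ _ covered ⟩
      sumFin N (λ i → card r (λ k → X i k ∧ Y k i))      ≡⟨ sumFin-swap N r (λ i k → bit (X i k ∧ Y k i)) ⟩
      sumFin r (λ k → card N (λ i → X i k ∧ Y k i))      ∎
      where
      open ≤-Reasoning
      covered : ∀ i → 1 ≤ card r (λ k → X i k ∧ Y k i)
      covered i = anyFin⇒card r _ (trans (decomp i i) (C-diagonal i))

    decompositionBound : p ≤ q + 1 → ∀ r (X : Mat N r) Y → IsDecomposition X Y →
                         ones X + ones Y + q′ * N ≤ r * N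
    decompositionBound p≤q+1 r X Y decomp = begin
      ones X + ones Y + q′ * N                  ≡⟨ cong (λ x → x + ones Y + q′ * N) (sumFin-swap N r (λ i k → bit (X i k))) ⟩
      sumFin r A + sumFin r B + q′ * N          ≤⟨ +-monoʳ-≤ (sumFin r A + sumFin r B)
                                                              (*-monoʳ-≤ q′ (diagonalCover X Y decomp)) ⟩
      sumFin r A + sumFin r B + q′ * sumFin r D ≡⟨ sym (cong₂ _+_ (sumFin-+ r A B) (sumFin-*ˡ r q′ D)) ⟩
      sumFin r (λ k → A k + B k) + sumFin r (λ k → q′ * D k)
                                                ≡⟨ sym (sumFin-+ r (λ k → A k + B k) (λ k → q′ * D k)) ⟩
      sumFin r (λ k → A k + B k + q′ * D k)     ≤⟨ sumFin-mono r _ _ perTerm ⟩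
      sumFin r (λ _ → N)                        ≡⟨ sumFin-const r N ⟩
      r * N                                     ∎
      where
      open ≤-Reasoning
      A B D : Fin r → ℕ
      A k = card N (λ i → X i k)
      B k = card N (λ j → Y k j)
      D k = card N (λ i → X i k ∧ Y k i)
      perTerm : ∀ k → A k + B k + q′ * D k ≤ N
      perTerm k = termBound p≤q+1 (λ i → X i k) (λ j → Y k j) (term-rectangle X Y decomp k)

  -- The theorem's bound involves r - n and so lives in ℤ: a bound
  -- x + k ≤ m in ℕ reads x ≤ m - k there.
  natBound⇒ℤ : ∀ x k m → x + k ≤ m → ℤ.+ x ℤ.≤ ℤ.+ m ℤ.- ℤ.+ k
  natBound⇒ℤ x k m x+k≤m = subst (ℤ.+ x ℤ.≤_) (sym (trans (ℤP.[+m]-[+n]≡m⊖n m k) (ℤP.⊖-≥ k≤m)))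
                                  (ℤ.+≤+ (m+n≤o⇒m≤o∸n x x+k≤m))
    where
    k≤m : k ≤ m
    k≤m = ≤-trans (m≤n+m k x) x+k≤m

  bound-rewrite : ∀ p′ q′ r → let n = suc p′ + suc q′ in
                  ℤ.+ (suc p′ + 1) ℤ.* ℤ.+ n ℤ.+ (ℤ.+ r ℤ.- ℤ.+ n) ℤ.* ℤ.+ n ≡ ℤ.+ (r * n) ℤ.- ℤ.+ (q′ * n)
  bound-rewrite p′ q′ r = begin
    A ℤ.* ℤ.+ n ℤ.+ (R ℤ.- ℤ.+ n) ℤ.* ℤ.+ n         ≡⟨ cong (λ z → A ℤ.* z ℤ.+ (R ℤ.- z) ℤ.* z) n≡A+Q ⟩
    A ℤ.* (A ℤ.+ Q) ℤ.+ (R ℤ.- (A ℤ.+ Q)) ℤ.* (A ℤ.+ Q) ≡⟨ expand A Q R ⟩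
    R ℤ.* (A ℤ.+ Q) ℤ.- Q ℤ.* (A ℤ.+ Q)              ≡⟨ cong (λ z → R ℤ.* z ℤ.- Q ℤ.* z) (sym n≡A+Q) ⟩
    R ℤ.* ℤ.+ n ℤ.- Q ℤ.* ℤ.+ n                      ≡⟨ sym (cong₂ ℤ._-_ (ℤP.pos-* r n) (ℤP.pos-* q′ n)) ⟩
    ℤ.+ (r * n) ℤ.- ℤ.+ (q′ * n)                      ∎
    where
    open ≡-Reasoning
    n = suc p′ + suc q′
    A Q R : ℤ
    A = ℤ.+ (suc p′ + 1)
    Q = ℤ.+ q′
    R = ℤ.+ r
    n≡A+Q : ℤ.+ n ≡ A ℤ.+ Q
    n≡A+Q = trans (cong ℤ.+_ (regroup p′ q′)) (ℤP.pos-+ (suc p′ + 1) q′)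
      where
      regroup : ∀ p′ q′ → suc p′ + suc q′ ≡ suc p′ + 1 + q′
      regroup = solve-∀
    expand : ∀ A Q R → A ℤ.* (A ℤ.+ Q) ℤ.+ (R ℤ.- (A ℤ.+ Q)) ℤ.* (A ℤ.+ Q)
                     ≡ R ℤ.* (A ℤ.+ Q) ℤ.- Q ℤ.* (A ℤ.+ Q)
    expand = ℤSolver.solve-∀

open import Defs
open import Data.Nat using (ℕ; _+_; _≤_)
open import Data.Integer using (ℤ; +_; _-_; _*_) renaming (_≤_ to _≤ℤ_; _+_ to _+ℤ_)
open import Relation.Binary.PropositionalEquality using (_≡_)

open import Data.Nat using (suc; s≤s; z≤n)
open import Relation.Binary.PropositionalEquality using (sym; subst)
open CirculantDecomposition using (natBound⇒ℤ; bound-rewrite; module Circulant)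

mainTheorem8 : (p q r : ℕ) → 1 ≤ p → 1 ≤ q → p ≤ q + 1 →
    (X : Mat (p + q) r) → (Y : Mat r (p + q)) → (∀ i j → (X ⊙ Y) i j ≡ C p q i j) →
    (+ (ones X + ones Y)) ≤ℤ (((+ (p + 1)) * (+ (p + q))) +ℤ (((+ r) - (+ (p + q))) * (+ (p + q))))
mainTheorem8 (suc p′) (suc q′) r (s≤s z≤n) (s≤s z≤n) p≤q+1 X Y decomposition =
  subst (+ (ones X + ones Y) ≤ℤ_) (sym (bound-rewrite p′ q′ r))
        (natBound⇒ℤ (ones X + ones Y) _ _ (Circulant.decompositionBound p′ q′ p≤q+1 r X Y decomposition))
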